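{- The lower weakly chordal switching class is equal to the lower $\{C_5,C_6,\overline{C_6}\}$-free switching class.
   Context: All graphs are finite and simple. For a graph $G$ and $A\subseteq V(G)$, the switching $S(G,A)$ is the graph on $V(G)$ whose edges are the edges of $G$ with both ends in $A$, the edges of $G$ with both ends outside $A$, and all pairs $uv$ with $u\in A$, $v\notin A$, $uv\notin E(G)$. For a graph class $\mathcal{G}$, the lower $\mathcal{G}$ switching class is the class of graphs $G$ such that $S(G,A)\in\mathcal{G}$ for every $A\subseteq V(G)$. A graph is weakly chordal if neither it nor its complement contains an induced cycle of length at least five. $\{C_5,C_6,\overline{C_6}\}$-free graphs are those with no induced subgraph isomorphic to the 5-cycle, the 6-cycle, or the complement of the 6-cycle. -}

module Defs where

open import Data.Nat using (ℕ; zero; suc; _≤_; _≡ᵇ_)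
open import Data.Fin using (Fin; toℕ)
open import Data.Bool using (Bool; true; false; not; _∧_; _∨_; _xor_; if_then_else_)
open import Data.Bool.Properties using (xor-comm; xor-same; ∨-comm)
open import Data.Product using (Σ; _×_; ∃-syntax; _,_)
open import Relation.Nullary using (¬_)
open import Relation.Binary.PropositionalEquality using (_≡_; refl; cong)
open import Function using (_⇔_)
open import Function.Definitions using (Injective)

record Graph : Set where
  field
    n      : ℕ
    adj    : Fin n → Fin n → Bool
    adj-sym    : ∀ u v → adj u v ≡ adj v u
    adj-irrefl : ∀ u → adj u u ≡ false

open Graph public

_=ᶠ_ : {k : ℕ} → Fin k → Fin k → Bool
i =ᶠ j = toℕ i ≡ᵇ toℕ j

≡ᵇ-refl : ∀ m → (m ≡ᵇ m) ≡ true
≡ᵇ-refl zero = refl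
≡ᵇ-refl (suc m) = ≡ᵇ-refl m

≡ᵇ-sym : ∀ m n → (m ≡ᵇ n) ≡ (n ≡ᵇ m)
≡ᵇ-sym zero zero = refl
≡ᵇ-sym zero (suc n) = refl
≡ᵇ-sym (suc m) zero = refl
≡ᵇ-sym (suc m) (suc n) = ≡ᵇ-sym m n

-- A subset A ⊆ V(G) is a Boolean characteristic function.
-- Switching S(G,A): an edge uv is toggled exactly when u and v lie on
-- different sides of A (A u xor A v = true); otherwise it is kept.
switch : (G : Graph) → (Fin (n G) → Bool) → Graph
switch G A = record
  { n = n G
  ; adj = λ u v → adj G u v xor (A u xor A v)
  ; adj-sym = λ u v → sw-sym u v
  ; adj-irrefl = λ u → sw-irr u
  }
  where
  sw-sym : ∀ u v → adj G u v xor (A u xor A v) ≡ adj G v u xor (A v xor A u)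
  sw-sym u v rewrite adj-sym G u v | xor-comm (A u) (A v) = refl
  sw-irr : ∀ u → adj G u u xor (A u xor A u) ≡ false
  sw-irr u rewrite adj-irrefl G u | xor-same (A u) = refl

complement : Graph → Graph
complement G = record
  { n = n G
  ; adj = λ u v → not (adj G u v) ∧ not (u =ᶠ v)
  ; adj-sym = λ u v → c-sym u v
  ; adj-irrefl = λ u → c-irr u
  }
  where
  c-sym : ∀ u v → not (adj G u v) ∧ not (u =ᶠ v) ≡ not (adj G v u) ∧ not (v =ᶠ u)
  c-sym u v rewrite adj-sym G u v | ≡ᵇ-sym (toℕ u) (toℕ v) = refl
  c-irr : ∀ u → not (adj G u u) ∧ not (u =ᶠ u) ≡ false
  c-irr u rewrite adj-irrefl G u | ≡ᵇ-refl (toℕ u) = refl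

HasInduced : (k : ℕ) → (Fin k → Fin k → Bool) → Graph → Set
HasInduced k H G =
  Σ (Fin k → Fin (n G)) λ f →
    Injective _≡_ _≡_ f × (∀ i j → adj G (f i) (f j) ≡ H i j)

succMod : {k : ℕ} → Fin k → ℕ
succMod {k} i = if suc (toℕ i) ≡ᵇ k then 0 else suc (toℕ i)

cycleAdj : (k : ℕ) → Fin k → Fin k → Bool
cycleAdj k i j = (succMod i ≡ᵇ toℕ j) ∨ (succMod j ≡ᵇ toℕ i)

coCycleAdj : (k : ℕ) → Fin k → Fin k → Bool
coCycleAdj k i j = not (cycleAdj k i j) ∧ not (i =ᶠ j)

GraphClass : Set₁
GraphClass = Graph → Set

WeaklyChordal : GraphClass
WeaklyChordal G =
  (∀ k → 5 ≤ k → ¬ HasInduced k (cycleAdj k) G) ×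
  (∀ k → 5 ≤ k → ¬ HasInduced k (cycleAdj k) (complement G))

C5C6coC6Free : GraphClass
C5C6coC6Free G =
  ¬ HasInduced 5 (cycleAdj 5) G ×
  ¬ HasInduced 6 (cycleAdj 6) G ×
  ¬ HasInduced 6 (coCycleAdj 6) G

LowerSwitching : GraphClass → GraphClass
LowerSwitching 𝒢 G = ∀ (A : Fin (n G) → Bool) → 𝒢 (switch G A)

_≐_ : GraphClass → GraphClass → Set
𝒢 ≐ ℋ = ∀ G → 𝒢 G ⇔ ℋ G

{-# OPTIONS --safe #-}
module Submission where

-- The holes C₅, C₆ and the antihole co-C₆ are forbidden in weakly chordal graphs, which gives one
-- inclusion. Conversely, an induced subgraph H of a switching of G, switched at a vertex set of H,
-- is again induced in a switching of G. Switching a hole (antihole) v₀v₁…v_{k-1} with k ≥ 7 at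
-- {v₀, v₃} makes v₀v₂v₁v₃v₅ (v₀v₁v₅v₂v₃) an induced C₅; a 5-antihole is a C₅, since C₅ is
-- self-complementary, and a 6-antihole is a co-C₆.

open import Defs
open import Algebra.Bundles using (CommutativeRing)
import Algebra.Properties.CommutativeSemigroup as CommutativeSemigroupProperties
open import Data.Bool using (Bool; true; false; not; _∧_; _∨_; _xor_)
open import Data.Bool.Properties
  using (xor-assoc; xor-∧-commutativeRing; T-≡; ⇔→≡; ¬-not; ∧-identityʳ; not-involutive)
import Data.Bool.Properties as Bool
open import Data.Empty using (⊥-elim)
open import Data.Fin using (Fin; toℕ; #_)
open import Data.Fin.Properties using (_≟_; toℕ-injective; any?; all?)
open import Data.Nat using (ℕ; suc; _+_; _≤_; _≡ᵇ_; s≤s; z≤n)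
open import Data.Nat.Properties using (≡ᵇ⇒≡; ≡⇒≡ᵇ; ≤-refl; n≤1+n)
open import Data.Product using (_×_; _,_; proj₁; proj₂; ∃-syntax)
open import Data.Vec using ([]; _∷_; lookup)
open import Function using (_∘_; _⇔_; mk⇔; Equivalence)
open import Function.Definitions using (Injective)
open import Relation.Nullary using (¬_; Dec; yes; no)
open import Relation.Nullary.Decidable using (True; toWitness; _×-dec_; _→-dec_)
open import Relation.Binary.PropositionalEquality using (_≡_; refl; sym; trans; cong; cong₂; module ≡-Reasoning)

open ≡-Reasoning

private
  variable
    t k : ℕ

Pattern : ℕ → Set
Pattern k = Fin k → Fin k → Bool

-- A record rather than the Σ-type of `HasInduced`, so that P and Q are inferable from it.
record _↪_ {t k} (P : Pattern t) (Q : Pattern k) : Set where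
  constructor embed
  field
    vertex     : Fin t → Fin k
    injective  : Injective _≡_ _≡_ vertex
    adj-vertex : ∀ a b → Q (vertex a) (vertex b) ≡ P a b

open _↪_ using (vertex)

HasInduced⇒↪ : (G : Graph) {P : Pattern t} → HasInduced t P G → P ↪ adj G
HasInduced⇒↪ G (f , f-inj , f-adj) = embed f f-inj f-adj

↪⇒HasInduced : (G : Graph) {P : Pattern t} → P ↪ adj G → HasInduced t P G
↪⇒HasInduced G (embed f f-inj f-adj) = f , f-inj , f-adj

↪-trans : ∀ {m} {P : Pattern t} {Q : Pattern k} {R : Pattern m} → P ↪ Q → Q ↪ R → P ↪ R
↪-trans (embed h h-inj h-adj) (embed f f-inj f-adj) =
  embed (λ a → f (h a)) (λ e → h-inj (f-inj e)) λ a b → trans (f-adj (h a) (h b)) (h-adj a b)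

↪-congʳ : {P : Pattern t} {Q R : Pattern k} → (∀ u v → Q u v ≡ R u v) → P ↪ Q → P ↪ R
↪-congʳ Q≗R (embed f f-inj f-adj) = embed f f-inj λ a b → trans (sym (Q≗R (f a) (f b))) (f-adj a b)

embeds? : (P : Pattern t) (Q : Pattern k) (h : Fin t → Fin k) →
          Dec ((∀ a b → h a ≡ h b → a ≡ b) × (∀ a b → Q (h a) (h b) ≡ P a b))
embeds? P Q h = all? (λ a → all? λ b → h a ≟ h b →-dec a ≟ b)
          ×-dec all? (λ a → all? λ b → Q (h a) (h b) Bool.≟ P a b)

embedding : {P : Pattern t} {Q : Pattern k} (h : Fin t → Fin k) → {True (embeds? P Q h)} → P ↪ Q
embedding h {ok} with toWitness ok
... | h-inj , h-adj = embed h (λ {a} {b} → h-inj a b) h-adj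

=ᶠ⇔≡ : {i j : Fin k} → (i =ᶠ j) ≡ true ⇔ i ≡ j
=ᶠ⇔≡ {i = i} {j} = mk⇔
  (λ e → toℕ-injective (≡ᵇ⇒≡ (toℕ i) (toℕ j) (Equivalence.from T-≡ e)))
  (λ e → Equivalence.to T-≡ (≡⇒≡ᵇ (toℕ i) (toℕ j) (cong toℕ e)))

=ᶠ-injective : {f : Fin t → Fin k} → Injective _≡_ _≡_ f → ∀ i j → (f i =ᶠ f j) ≡ (i =ᶠ j)
=ᶠ-injective {f = f} f-inj i j = ⇔→≡ (mk⇔
  (λ e → Equivalence.from =ᶠ⇔≡ (f-inj (Equivalence.to =ᶠ⇔≡ e)))
  (λ e → Equivalence.from =ᶠ⇔≡ (cong f (Equivalence.to =ᶠ⇔≡ e))))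

-- Definitionally, adj (complement G) = complementᴾ (adj G) and coCycleAdj k = complementᴾ (cycleAdj k).
complementᴾ : Pattern k → Pattern k
complementᴾ P i j = not (P i j) ∧ not (i =ᶠ j)

↪-complement : {P : Pattern t} {Q : Pattern k} → P ↪ Q → complementᴾ P ↪ complementᴾ Q
↪-complement (embed f f-inj f-adj) =
  embed f f-inj λ a b → cong₂ (λ x y → not x ∧ not y) (f-adj a b) (=ᶠ-injective f-inj a b)

complementᴾ-involutive : {Q : Pattern k} → (∀ u → Q u u ≡ false) →
                         ∀ u v → complementᴾ (complementᴾ Q) u v ≡ Q u v
complementᴾ-involutive {Q = Q} Q-irrefl u v with u ≟ v
... | yes refl rewrite Q-irrefl u | ≡ᵇ-refl (toℕ u) = refl
... | no u≢v rewrite ¬-not (u≢v ∘ Equivalence.to =ᶠ⇔≡) = begin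
  not (not (Q u v) ∧ true) ∧ true ≡⟨ ∧-identityʳ _ ⟩
  not (not (Q u v) ∧ true)        ≡⟨ cong not (∧-identityʳ _) ⟩
  not (not (Q u v))               ≡⟨ not-involutive _ ⟩
  Q u v                           ∎

complement-↪ : {P : Pattern t} {Q : Pattern k} → (∀ u → Q u u ≡ false) →
               P ↪ complementᴾ Q → complementᴾ P ↪ Q
complement-↪ Q-irrefl e = ↪-congʳ (complementᴾ-involutive Q-irrefl) (↪-complement e)

-- Definitionally, adj (switch G A) = switchᴾ (adj G) A.
switchᴾ : Pattern k → (Fin k → Bool) → Pattern k
switchᴾ P A i j = P i j xor (A i xor A j)

xor-interchange : ∀ a b c d → (a xor b) xor (c xor d) ≡ (a xor c) xor (b xor d)
xor-interchange = interchange
  where open CommutativeSemigroupProperties (CommutativeRing.+-commutativeSemigroup xor-∧-commutativeRing)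

switchᴾ-xor : ∀ (Q : Pattern k) A B u v →
              switchᴾ Q (λ w → A w xor B w) u v ≡ switchᴾ (switchᴾ Q A) B u v
switchᴾ-xor Q A B u v = trans
  (cong (Q u v xor_) (xor-interchange (A u) (B u) (A v) (B v)))
  (sym (xor-assoc (Q u v) (A u xor A v) (B u xor B v)))

extension : (Fin t → Fin k) → (Fin t → Bool) → Fin k → Bool
extension f S v with any? (λ i → f i ≟ v)
... | yes (i , _) = S i
... | no _        = false

extension-∘ : {f : Fin t → Fin k} → Injective _≡_ _≡_ f → ∀ S i → extension f S (f i) ≡ S i
extension-∘ {f = f} f-inj S i with any? (λ j → f j ≟ f i)
... | yes (j , fj≡fi) = cong S (f-inj fj≡fi)
... | no ∄j           = ⊥-elim (∄j (i , refl))

↪-switch : {P : Pattern t} {Q : Pattern k} (e : P ↪ Q) →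
           ∀ S → switchᴾ P S ↪ switchᴾ Q (extension (vertex e) S)
↪-switch (embed f f-inj f-adj) S = embed f f-inj λ a b →
  cong₂ _xor_ (f-adj a b) (cong₂ _xor_ (extension-∘ f-inj S a) (extension-∘ f-inj S b))

switch-↪ : (G : Graph) (A : Fin (n G) → Bool) {P : Pattern t} → P ↪ adj (switch G A) →
           ∀ S → ∃[ B ] switchᴾ P S ↪ adj (switch G B)
switch-↪ G A e S = (λ v → A v xor B v) , ↪-congʳ (λ u v → sym (switchᴾ-xor (adj G) A B u v)) (↪-switch e S)
  where
  B : Fin (n G) → Bool
  B = extension (vertex e) S

at0or3 : Fin k → Bool
at0or3 i = (toℕ i ≡ᵇ 0) ∨ (toℕ i ≡ᵇ 3)

C₅↪coC₅ : cycleAdj 5 ↪ coCycleAdj 5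
C₅↪coC₅ = embedding (lookup (# 0 ∷ # 2 ∷ # 4 ∷ # 1 ∷ # 3 ∷ []))

C₆↪complement-coC₆ : cycleAdj 6 ↪ complementᴾ (coCycleAdj 6)
C₆↪complement-coC₆ = embedding (λ i → i)

C₅↪switch-C₇₊ : ∀ m → cycleAdj 5 ↪ switchᴾ (cycleAdj (7 + m)) at0or3
C₅↪switch-C₇₊ m = embedding (lookup (# 0 ∷ # 2 ∷ # 1 ∷ # 3 ∷ # 5 ∷ []))

C₅↪switch-coC₇₊ : ∀ m → cycleAdj 5 ↪ switchᴾ (coCycleAdj (7 + m)) at0or3
C₅↪switch-coC₇₊ m = embedding (lookup (# 0 ∷ # 1 ∷ # 5 ∷ # 2 ∷ # 3 ∷ []))

≥5-cases : (P : ℕ → Set) → P 5 → P 6 → (∀ m → P (7 + m)) → ∀ k → 5 ≤ k → P k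
≥5-cases _ p₅ p₆ p₇₊ _ (s≤s (s≤s (s≤s (s≤s (s≤s {n = 0} z≤n)))))           = p₅
≥5-cases _ p₅ p₆ p₇₊ _ (s≤s (s≤s (s≤s (s≤s (s≤s {n = 1} z≤n)))))           = p₆
≥5-cases _ p₅ p₆ p₇₊ _ (s≤s (s≤s (s≤s (s≤s (s≤s {n = suc (suc m)} z≤n))))) = p₇₊ m

weaklyChordal⇒C5C6coC6Free : ∀ G → WeaklyChordal G → C5C6coC6Free G
weaklyChordal⇒C5C6coC6Free G (noHole , noAntihole) =
    noHole 5 ≤-refl
  , noHole 6 (n≤1+n 5)
  , λ coC₆ → noAntihole 6 (n≤1+n 5) (↪⇒HasInduced (complement G)
                 (↪-trans C₆↪complement-coC₆ (↪-complement (HasInduced⇒↪ G coC₆))))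

lowerFree⇒lowerWeaklyChordal : ∀ G → LowerSwitching C5C6coC6Free G → LowerSwitching WeaklyChordal G
lowerFree⇒lowerWeaklyChordal G free A = noHole , noAntihole
  where
  noC₅ : ∀ B → ¬ (cycleAdj 5 ↪ adj (switch G B))
  noC₅ B C₅ = proj₁ (free B) (↪⇒HasInduced (switch G B) C₅)

  noHole : ∀ k → 5 ≤ k → ¬ HasInduced k (cycleAdj k) (switch G A)
  noHole = ≥5-cases (λ k → ¬ HasInduced k (cycleAdj k) (switch G A))
    (proj₁ (free A))
    (proj₁ (proj₂ (free A)))
    λ m hole → let B , switched = switch-↪ G A (HasInduced⇒↪ (switch G A) hole) at0or3
               in noC₅ B (↪-trans (C₅↪switch-C₇₊ m) switched)

  noAntihole : ∀ k → 5 ≤ k → ¬ HasInduced k (cycleAdj k) (complement (switch G A))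
  noAntihole = ≥5-cases (λ k → ¬ HasInduced k (cycleAdj k) (complement (switch G A)))
    (λ antihole → noC₅ A (↪-trans C₅↪coC₅ (coHole antihole)))
    (λ antihole → proj₂ (proj₂ (free A)) (↪⇒HasInduced (switch G A) (coHole antihole)))
    λ m antihole → let B , switched = switch-↪ G A (coHole antihole) at0or3
                   in noC₅ B (↪-trans (C₅↪switch-coC₇₊ m) switched)
    where
    coHole : ∀ {k} → HasInduced k (cycleAdj k) (complement (switch G A)) →
             coCycleAdj k ↪ adj (switch G A)
    coHole antihole = complement-↪ (adj-irrefl (switch G A))
                        (HasInduced⇒↪ (complement (switch G A)) antihole)

mainTheorem18 : LowerSwitching WeaklyChordal ≐ LowerSwitching C5C6coC6Free
mainTheorem18 G = mk⇔
  (λ weaklyChordal A → weaklyChordal⇒C5C6coC6Free (switch G A) (weaklyChordal A))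
  (lowerFree⇒lowerWeaklyChordal G)
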